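{- For every integer $k\ge 1$, the olive tree $T_k$ is a difference graph.
   Context: A graph $G=(V,E)$ is a difference graph if there is a bijection $f$ from $V$ onto a set $S$ of positive integers such that for all distinct $x,y\in V$: $xy\in E$ if and only if $|f(x)-f(y)|\in S$. The olive tree $T_k$ is a rooted tree consisting of $k$ branches where, for $i=1,\dots,k$, the $i$-th branch is a path of length $i$ starting at the root; distinct branches share only the root. -}

module Defs where

open import Data.Nat using (ℕ; suc; _<_; ∣_-_∣)
open import Data.Fin using (Fin; toℕ; zero)
open import Data.Product using (Σ; ∃; _×_)
open import Relation.Binary.PropositionalEquality using (_≡_; _≢_)
open import Function.Bundles using (_⇔_)
open import Function.Definitions using (Injective)

record Graph : Set₁ where
  field
    Vertex : Set
    Adj    : Vertex → Vertex → Set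

IsDifferenceGraph : Graph → Set
IsDifferenceGraph G =
  Σ (Vertex → ℕ) λ f →
      Injective _≡_ _≡_ f
    × (∀ x → 0 < f x)
    × (∀ x y → x ≢ y → (Adj x y ⇔ ∃ λ v → f v ≡ ∣ f x - f y ∣))
  where open Graph G

-- Vertices of the olive tree T_k: the root, and for each branch index
-- i ∈ {0,…,k-1} (branch number i+1, a path of length i+1 from the root)
-- the vertex at distance j+1 from the root, j ∈ {0,…,i}.
data OliveVertex (k : ℕ) : Set where
  root : OliveVertex k
  node : (i : Fin k) → (j : Fin (suc (toℕ i))) → OliveVertex k

data OliveAdj (k : ℕ) : OliveVertex k → OliveVertex k → Set where
  root-first : ∀ i → OliveAdj k root (node i zero)
  first-root : ∀ i → OliveAdj k (node i zero) root
  step-out   : ∀ i (j j′ : Fin (suc (toℕ i))) → toℕ j′ ≡ suc (toℕ j) →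
               OliveAdj k (node i j) (node i j′)
  step-in    : ∀ i (j j′ : Fin (suc (toℕ i))) → toℕ j ≡ suc (toℕ j′) →
               OliveAdj k (node i j) (node i j′)


OliveTree : ℕ → Graph
OliveTree k = record { Vertex = OliveVertex k ; Adj = OliveAdj k }

-- Label the root 1 and the vertex of the one-edge branch 2.  The branch of
-- length i + 2 gets the block of exponents starting at e = 3 + i·k: its first
-- vertex is labelled 2^e + 1 and its vertex at depth d ≥ 2 is labelled
-- 2^(e + d - 2).  Along every edge the difference is 1 or the smaller of two
-- consecutive powers, hence a label.  Conversely, a label is a sum of two
-- labels only as 2^a + 2^a = 2^(a+1), 1 + 2^e = 2^e + 1 or
-- 2^(e-1) + (2^(e-1) + 1) = 2^e + 1, up to order.  The first two occur only
-- along edges, and the last needs two first vertices with consecutive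
-- exponents, which the gaps between the blocks exclude.
module Submission where

open import Data.Nat using (ℕ; zero; suc; _+_; _*_; _^_; _<_; _≤_; ∣_-_∣; NonZero; z<s; s≤s)
open import Data.Nat.Properties
open import Data.Nat.DivMod using (_%_; [m+kn]%n≡m%n; m<n⇒m%n≡m)
open import Data.Nat.Tactic.RingSolver using (solve-∀)
open import Data.Fin using (Fin; zero; suc; toℕ)
open import Data.Fin.Properties using (toℕ-injective; toℕ<n)
open import Data.Product using (_×_; _,_; proj₁; proj₂; map₂; ∃; ∃₂)
open import Data.Sum using (_⊎_; inj₁; inj₂)
open import Data.Empty using (⊥; ⊥-elim)
open import Relation.Binary.PropositionalEquality
open import Function.Bundles using (mk⇔)
open import Function.Definitions using (Injective)

open import Defs

2^≢0 : ∀ a → 2 ^ a ≢ 0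
2^≢0 a = >⇒≢ (m^n>0 2 a)

2^a≡1+2m⇒a≡0∧m≡0 : ∀ a m → 2 ^ a ≡ suc (2 * m) → a ≡ 0 × m ≡ 0
2^a≡1+2m⇒a≡0∧m≡0 zero    m e = refl , m+n≡0⇒m≡0 m (sym (suc-injective e))
2^a≡1+2m⇒a≡0∧m≡0 (suc a) m e = ⊥-elim (even≢odd (2 ^ a) m e)

2^-injective : ∀ {a b} → 2 ^ a ≡ 2 ^ b → a ≡ b
2^-injective {zero}  {zero}  _ = refl
2^-injective {zero}  {suc b} e with () ← proj₁ (2^a≡1+2m⇒a≡0∧m≡0 (suc b) 0 (sym e))
2^-injective {suc a} {zero}  e with () ← proj₁ (2^a≡1+2m⇒a≡0∧m≡0 (suc a) 0 e)
2^-injective {suc a} {suc b} e = cong suc (2^-injective (*-cancelˡ-≡ _ _ 2 e))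

2^a+2^b≡2^c⇒a≡b∧c≡1+a : ∀ a b c → 2 ^ a + 2 ^ b ≡ 2 ^ c → a ≡ b × c ≡ suc a
2^a+2^b≡2^c⇒a≡b∧c≡1+a zero    zero    zero    ()
2^a+2^b≡2^c⇒a≡b∧c≡1+a zero    zero    (suc c) e =
  refl , cong suc (2^-injective (sym (*-cancelˡ-≡ 1 (2 ^ c) 2 e)))
2^a+2^b≡2^c⇒a≡b∧c≡1+a zero    (suc b) c       e =
  ⊥-elim (2^≢0 b (proj₂ (2^a≡1+2m⇒a≡0∧m≡0 c (2 ^ b) (sym e))))
2^a+2^b≡2^c⇒a≡b∧c≡1+a (suc a) zero    c       e =
  ⊥-elim (2^≢0 a (proj₂ (2^a≡1+2m⇒a≡0∧m≡0 c (2 ^ a) (sym (trans (+-comm 1 (2 ^ suc a)) e)))))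
2^a+2^b≡2^c⇒a≡b∧c≡1+a (suc a) (suc b) zero    e =
  ⊥-elim (even≢odd (2 ^ a + 2 ^ b) 0 (trans (*-distribˡ-+ 2 (2 ^ a) (2 ^ b)) e))
2^a+2^b≡2^c⇒a≡b∧c≡1+a (suc a) (suc b) (suc c) e
  with refl , refl ← 2^a+2^b≡2^c⇒a≡b∧c≡1+a a b c
                       (*-cancelˡ-≡ (2 ^ a + 2 ^ b) (2 ^ c) 2 (trans (*-distribˡ-+ 2 (2 ^ a) (2 ^ b)) e))
  = refl , refl

-- The offset 2 in pow+1 keeps its values, and sums of two of them, off the
-- powers of two.
data Label : Set where
  pow   : ℕ → Label
  pow+1 : ℕ → Label

⟦_⟧ : Label → ℕ
⟦ pow a ⟧   = 2 ^ a
⟦ pow+1 c ⟧ = suc (2 ^ (2 + c))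

⟦⟧-positive : ∀ x → 0 < ⟦ x ⟧
⟦⟧-positive (pow a)   = m^n>0 2 a
⟦⟧-positive (pow+1 c) = z<s

⟦pow⟧≢⟦pow+1⟧ : ∀ a c → ⟦ pow a ⟧ ≢ ⟦ pow+1 c ⟧
⟦pow⟧≢⟦pow+1⟧ a c e = 2^≢0 (suc c) (proj₂ (2^a≡1+2m⇒a≡0∧m≡0 a (2 ^ suc c) e))

⟦⟧-injective : Injective _≡_ _≡_ ⟦_⟧
⟦⟧-injective {pow a}   {pow b}   e = cong pow (2^-injective e)
⟦⟧-injective {pow a}   {pow+1 c} e = ⊥-elim (⟦pow⟧≢⟦pow+1⟧ a c e)
⟦⟧-injective {pow+1 c} {pow a}   e = ⊥-elim (⟦pow⟧≢⟦pow+1⟧ a c (sym e))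
⟦⟧-injective {pow+1 c} {pow+1 d} e =
  cong pow+1 (suc-injective (suc-injective (2^-injective (suc-injective e))))

⟦pow⟧+⟦pow⟧≡⟦pow+1⟧ : ∀ a b c → ⟦ pow a ⟧ + ⟦ pow b ⟧ ≡ ⟦ pow+1 c ⟧ →
                     a ≡ 0 × b ≡ 2 + c ⊎ b ≡ 0 × a ≡ 2 + c
⟦pow⟧+⟦pow⟧≡⟦pow+1⟧ zero    zero    c e = ⊥-elim (even≢odd (2 ^ suc c) 0 (sym (suc-injective e)))
⟦pow⟧+⟦pow⟧≡⟦pow+1⟧ zero    (suc b) c e = inj₁ (refl , 2^-injective (suc-injective e))
⟦pow⟧+⟦pow⟧≡⟦pow+1⟧ (suc a) zero    c e =
  inj₂ (refl , 2^-injective (suc-injective (trans (+-comm 1 (2 ^ suc a)) e)))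
⟦pow⟧+⟦pow⟧≡⟦pow+1⟧ (suc a) (suc b) c e =
  ⊥-elim (even≢odd (2 ^ a + 2 ^ b) (2 ^ suc c) (trans (*-distribˡ-+ 2 (2 ^ a) (2 ^ b)) e))

⟦pow⟧+⟦pow+1⟧≢⟦pow⟧ : ∀ a b c → ⟦ pow a ⟧ + ⟦ pow+1 b ⟧ ≢ ⟦ pow c ⟧
⟦pow⟧+⟦pow+1⟧≢⟦pow⟧ zero    b c e with () ← proj₁ (2^a+2^b≡2^c⇒a≡b∧c≡1+a 1 (2 + b) c e)
⟦pow⟧+⟦pow+1⟧≢⟦pow⟧ (suc a) b c e =
  2^≢0 a (m+n≡0⇒m≡0 (2 ^ a) (proj₂ (2^a≡1+2m⇒a≡0∧m≡0 c (2 ^ a + 2 ^ suc b) (trans (sym e) odd))))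
  where
  odd : 2 ^ suc a + ⟦ pow+1 b ⟧ ≡ suc (2 * (2 ^ a + 2 ^ suc b))
  odd = trans (+-suc (2 ^ suc a) (2 ^ (2 + b)))
              (cong suc (sym (*-distribˡ-+ 2 (2 ^ a) (2 ^ suc b))))

⟦pow⟧+⟦pow+1⟧≡⟦pow+1⟧ : ∀ a b c → ⟦ pow a ⟧ + ⟦ pow+1 b ⟧ ≡ ⟦ pow+1 c ⟧ → a ≡ 2 + b × c ≡ suc b
⟦pow⟧+⟦pow+1⟧≡⟦pow+1⟧ a b c e
  with refl , c≡1+a ← 2^a+2^b≡2^c⇒a≡b∧c≡1+a a (2 + b) (2 + c)
                        (suc-injective (trans (sym (+-suc (2 ^ a) (2 ^ (2 + b)))) e))
  = refl , suc-injective (suc-injective c≡1+a)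

⟦pow+1⟧+⟦pow+1⟧≡2[1+2m] : ∀ a b → ⟦ pow+1 a ⟧ + ⟦ pow+1 b ⟧ ≡ 2 * suc (2 * (2 ^ a + 2 ^ b))
⟦pow+1⟧+⟦pow+1⟧≡2[1+2m] a b = identity (2 ^ a) (2 ^ b)
  where
  identity : ∀ x y → suc (2 * (2 * x)) + suc (2 * (2 * y)) ≡ 2 * suc (2 * (x + y))
  identity = solve-∀

⟦pow+1⟧+⟦pow+1⟧≢⟦pow⟧ : ∀ a b c → ⟦ pow+1 a ⟧ + ⟦ pow+1 b ⟧ ≢ ⟦ pow c ⟧
⟦pow+1⟧+⟦pow+1⟧≢⟦pow⟧ a b zero    e =
  even≢odd (suc (2 * (2 ^ a + 2 ^ b))) 0 (trans (sym (⟦pow+1⟧+⟦pow+1⟧≡2[1+2m] a b)) e)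
⟦pow+1⟧+⟦pow+1⟧≢⟦pow⟧ a b (suc c) e =
  2^≢0 a (m+n≡0⇒m≡0 (2 ^ a) (proj₂ (2^a≡1+2m⇒a≡0∧m≡0 c (2 ^ a + 2 ^ b) (sym half))))
  where
  half : suc (2 * (2 ^ a + 2 ^ b)) ≡ 2 ^ c
  half = *-cancelˡ-≡ _ (2 ^ c) 2 (trans (sym (⟦pow+1⟧+⟦pow+1⟧≡2[1+2m] a b)) e)

⟦pow+1⟧+⟦pow+1⟧≢⟦pow+1⟧ : ∀ a b c → ⟦ pow+1 a ⟧ + ⟦ pow+1 b ⟧ ≢ ⟦ pow+1 c ⟧
⟦pow+1⟧+⟦pow+1⟧≢⟦pow+1⟧ a b c e =
  even≢odd (suc (2 * (2 ^ a + 2 ^ b))) (2 ^ suc c) (trans (sym (⟦pow+1⟧+⟦pow+1⟧≡2[1+2m] a b)) e)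

infix 4 _≐_+_
data _≐_+_ : Label → Label → Label → Set where
  doubling : ∀ a → pow (suc a) ≐ pow a + pow a
  one+pow  : ∀ c → pow+1 c ≐ pow 0 + pow (2 + c)
  pow+one  : ∀ c → pow+1 c ≐ pow (2 + c) + pow 0
  carryˡ   : ∀ b → pow+1 (suc b) ≐ pow (2 + b) + pow+1 b
  carryʳ   : ∀ b → pow+1 (suc b) ≐ pow+1 b + pow (2 + b)

label-sum : ∀ x y z → ⟦ x ⟧ ≡ ⟦ y ⟧ + ⟦ z ⟧ → x ≐ y + z
label-sum (pow c) (pow a) (pow b) e
  with refl , refl ← 2^a+2^b≡2^c⇒a≡b∧c≡1+a a b c (sym e) = doubling a
label-sum (pow+1 c) (pow a) (pow b) e with ⟦pow⟧+⟦pow⟧≡⟦pow+1⟧ a b c (sym e)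
... | inj₁ (refl , refl) = one+pow c
... | inj₂ (refl , refl) = pow+one c
label-sum (pow c) (pow a) (pow+1 b) e = ⊥-elim (⟦pow⟧+⟦pow+1⟧≢⟦pow⟧ a b c (sym e))
label-sum (pow c) (pow+1 a) (pow b) e =
  ⊥-elim (⟦pow⟧+⟦pow+1⟧≢⟦pow⟧ b a c (trans (+-comm (2 ^ b) _) (sym e)))
label-sum (pow+1 c) (pow a) (pow+1 b) e
  with refl , refl ← ⟦pow⟧+⟦pow+1⟧≡⟦pow+1⟧ a b c (sym e) = carryˡ b
label-sum (pow+1 c) (pow+1 a) (pow b) e
  with refl , refl ← ⟦pow⟧+⟦pow+1⟧≡⟦pow+1⟧ b a c (trans (+-comm (2 ^ b) _) (sym e)) = carryʳ a
label-sum (pow c)   (pow+1 a) (pow+1 b) e = ⊥-elim (⟦pow+1⟧+⟦pow+1⟧≢⟦pow⟧ a b c (sym e))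
label-sum (pow+1 c) (pow+1 a) (pow+1 b) e = ⊥-elim (⟦pow+1⟧+⟦pow+1⟧≢⟦pow+1⟧ a b c (sym e))

remainder-unique : ∀ {m} .{{_ : NonZero m}} {r s a b} →
                   r < m → s < m → r + a * m ≡ s + b * m → r ≡ s
remainder-unique {m} {r = r} {s} {a} {b} r<m s<m e = begin
  r               ≡⟨ m<n⇒m%n≡m r<m ⟨
  r % m           ≡⟨ [m+kn]%n≡m%n r a m ⟨
  (r + a * m) % m ≡⟨ cong (_% m) e ⟩
  (s + b * m) % m ≡⟨ [m+kn]%n≡m%n s b m ⟩
  s % m           ≡⟨ m<n⇒m%n≡m s<m ⟩
  s               ∎
  where open ≡-Reasoning

quotRem-unique : ∀ {m} .{{_ : NonZero m}} {r s a b} →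
                 r < m → s < m → r + a * m ≡ s + b * m → r ≡ s × a ≡ b
quotRem-unique {m} {r = r} {a = a} {b} r<m s<m e
  with refl ← remainder-unique {a = a} {b} r<m s<m e =
  refl , *-cancelʳ-≡ a b m (+-cancelˡ-≡ r (a * m) (b * m) e)

nested-toℕ<n : ∀ {n} (i : Fin n) (j : Fin (suc (toℕ i))) → toℕ j < n
nested-toℕ<n i j = <-≤-trans (toℕ<n j) (toℕ<n i)

∣1+n-n∣≡1 : ∀ n → ∣ suc n - n ∣ ≡ 1
∣1+n-n∣≡1 zero    = refl
∣1+n-n∣≡1 (suc n) = ∣1+n-n∣≡1 n

∣n-2n∣≡n : ∀ n → ∣ n - 2 * n ∣ ≡ n
∣n-2n∣≡n n = trans (∣m-m+n∣≡n n (n + 0)) (+-identityʳ n)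

m≡n+∣m-n∣⊎n≡m+∣m-n∣ : ∀ m n → m ≡ n + ∣ m - n ∣ ⊎ n ≡ m + ∣ m - n ∣
m≡n+∣m-n∣⊎n≡m+∣m-n∣ zero    n       = inj₂ refl
m≡n+∣m-n∣⊎n≡m+∣m-n∣ (suc m) zero    = inj₁ refl
m≡n+∣m-n∣⊎n≡m+∣m-n∣ (suc m) (suc n) with m≡n+∣m-n∣⊎n≡m+∣m-n∣ m n
... | inj₁ e = inj₁ (cong suc e)
... | inj₂ e = inj₂ (cong suc e)

module OliveLabelling (n : ℕ) where

  infix 4 _~_
  _~_ : OliveVertex (suc n) → OliveVertex (suc n) → Set
  _~_ = OliveAdj (suc n)

  ~-sym : ∀ {x y} → x ~ y → y ~ x
  ~-sym (root-first i)      = first-root i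
  ~-sym (first-root i)      = root-first i
  ~-sym (step-out i j j′ e) = step-in i j′ j e
  ~-sym (step-in i j j′ e)  = step-out i j′ j e

  -- node (suc i) j lies on the branch of length i + 2, whose block of
  -- exponents starts at 3 + index i zero; the blocks have width k = suc n.
  index : (i : Fin n) → Fin (suc (toℕ i)) → ℕ
  index i j = toℕ j + toℕ i * suc n

  index-shift : ∀ r (i i′ : Fin n) j j′ → r + toℕ j′ < suc n →
                r + index i′ j′ ≡ index i j → i′ ≡ i × r + toℕ j′ ≡ toℕ j
  index-shift r i i′ j j′ bound e
    with r+j′≡j , i′≡i ← quotRem-unique bound (m<n⇒m<1+n (nested-toℕ<n i j))
                           (trans (+-assoc r (toℕ j′) (toℕ i′ * suc n)) e)
    = toℕ-injective i′≡i , r+j′≡j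

  label : OliveVertex (suc n) → Label
  label root                  = pow 0
  label (node zero zero)      = pow 1
  label (node zero (suc ()))
  label (node (suc i) zero)    = pow+1 (suc (index i zero))
  label (node (suc i) (suc j)) = pow (3 + index i j)

  value : OliveVertex (suc n) → ℕ
  value x = ⟦ label x ⟧

  pow0-inverse : ∀ x → label x ≡ pow 0 → x ≡ root
  pow0-inverse root                  _ = refl
  pow0-inverse (node zero zero)      ()
  pow0-inverse (node zero (suc ()))  _
  pow0-inverse (node (suc i) zero)    ()
  pow0-inverse (node (suc i) (suc j)) ()

  pow1-inverse : ∀ x → label x ≡ pow 1 → x ≡ node zero zero
  pow1-inverse root                  ()
  pow1-inverse (node zero zero)      _ = refl
  pow1-inverse (node zero (suc ()))  _
  pow1-inverse (node (suc i) zero)    ()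
  pow1-inverse (node (suc i) (suc j)) ()

  pow2+-inverse : ∀ x {a} → label x ≡ pow (2 + a) →
                  ∃₂ λ i j → x ≡ node (suc i) (suc j) × suc (index i j) ≡ a
  pow2+-inverse root                  ()
  pow2+-inverse (node zero zero)      ()
  pow2+-inverse (node zero (suc ()))  _
  pow2+-inverse (node (suc i) zero)    ()
  pow2+-inverse (node (suc i) (suc j)) refl = i , j , refl , refl

  pow+1-inverse : ∀ x {c} → label x ≡ pow+1 c →
                  ∃ λ i → x ≡ node (suc i) zero × suc (index i zero) ≡ c
  pow+1-inverse root                  ()
  pow+1-inverse (node zero zero)      ()
  pow+1-inverse (node zero (suc ()))  _
  pow+1-inverse (node (suc i) zero)    refl = i , refl , refl
  pow+1-inverse (node (suc i) (suc j)) ()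

  label-injective : ∀ x y → label x ≡ label y → x ≡ y
  label-injective root             y e = sym (pow0-inverse y (sym e))
  label-injective (node zero zero) y e = sym (pow1-inverse y (sym e))
  label-injective (node zero (suc ())) _ _
  label-injective (node (suc i) zero) y e
    with i′ , refl , i′≡i ← pow+1-inverse y (sym e)
    with refl , _ ← index-shift 0 i i′ zero zero z<s (suc-injective i′≡i)
    = refl
  label-injective (node (suc i) (suc j)) y e
    with i′ , j′ , refl , same ← pow2+-inverse y (sym e)
    with refl , j′≡j ← index-shift 0 i i′ j j′ (m<n⇒m<1+n (nested-toℕ<n i′ j′))
                                   (suc-injective same)
    with refl ← toℕ-injective j′≡j
    = refl

  value-injective : Injective _≡_ _≡_ value
  value-injective {x} {y} e = label-injective x y (⟦⟧-injective e)

  doubling-adjacent : ∀ x y {a} → label x ≡ pow (suc a) → label y ≡ pow a → x ~ y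
  doubling-adjacent x y {zero} ex ey
    with refl ← pow1-inverse x ex | refl ← pow0-inverse y ey = first-root zero
  doubling-adjacent x y {1} ex ey with _ , _ , _ , () ← pow2+-inverse x ex
  doubling-adjacent x y {suc (suc a)} ex ey
    with i , j , refl , refl ← pow2+-inverse x ex
    with i′ , j′ , refl , shift ← pow2+-inverse y ey
    with refl , 1+j′≡j ← index-shift 1 i i′ j j′ (s≤s (nested-toℕ<n i′ j′)) shift
    = step-in (suc i) (suc j) (suc j′) (cong suc (sym 1+j′≡j))

  first-adjacent-second : ∀ x y {c} → label x ≡ pow+1 c → label y ≡ pow (2 + c) → x ~ y
  first-adjacent-second x y ex ey
    with i , refl , refl ← pow+1-inverse x ex
    with i′ , j′ , refl , same ← pow2+-inverse y ey
    with refl , j′≡0 ← index-shift 0 i i′ zero j′ (m<n⇒m<1+n (nested-toℕ<n i′ j′))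
                                   (suc-injective same)
    = step-out (suc i) zero (suc j′) (cong suc j′≡0)

  first-labels-not-consecutive : ∀ x y {b} → label x ≡ pow+1 (suc b) → label y ≡ pow+1 b → ⊥
  first-labels-not-consecutive x y ex ey
    with i , refl , refl ← pow+1-inverse x ex
    with i′ , refl , shift ← pow+1-inverse y ey
    with _ , () ← index-shift 1 i i′ zero zero (s≤s (nested-toℕ<n i′ zero)) shift

  split-adjacent : ∀ {x y z X Y Z} → label x ≡ X → label y ≡ Y → label z ≡ Z → X ≐ Y + Z → x ~ y
  split-adjacent {x} {y} ex ey _ (doubling a) = doubling-adjacent x y ex ey
  split-adjacent {x} {y} ex ey _ (one+pow c)
    with i , refl , _ ← pow+1-inverse x ex | refl ← pow0-inverse y ey = first-root (suc i)
  split-adjacent {x} {y} ex ey _ (pow+one c) = first-adjacent-second x y ex ey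
  split-adjacent {x} {z = z} ex _ ez (carryˡ b) = ⊥-elim (first-labels-not-consecutive x z ex ez)
  split-adjacent {x} {y} ex ey _ (carryʳ b) = ⊥-elim (first-labels-not-consecutive x y ex ey)

  sum-adjacent : ∀ x y z → value x ≡ value y + value z → x ~ y
  sum-adjacent x y z e = split-adjacent refl refl refl (label-sum (label x) (label y) (label z) e)

  difference-adjacent : ∀ x y v → value v ≡ ∣ value x - value y ∣ → x ~ y
  difference-adjacent x y v e with m≡n+∣m-n∣⊎n≡m+∣m-n∣ (value x) (value y)
  ... | inj₁ x≡y+d = sum-adjacent x y v (trans x≡y+d (cong (value y +_) (sym e)))
  ... | inj₂ y≡x+d = ~-sym (sum-adjacent y x v (trans y≡x+d (cong (value x +_) (sym e))))

  LabelledDifference : OliveVertex (suc n) → OliveVertex (suc n) → Set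
  LabelledDifference x y = ∃ λ v → value v ≡ ∣ value x - value y ∣

  root-first-difference : ∀ i → LabelledDifference root (node i zero)
  root-first-difference zero    = root , refl
  root-first-difference (suc i) = node (suc i) (suc zero) , refl

  step-out-difference : ∀ i j j′ → toℕ j′ ≡ suc (toℕ j) → LabelledDifference (node i j) (node i j′)
  step-out-difference zero    zero     zero     ()
  step-out-difference zero    zero     (suc ()) _
  step-out-difference zero    (suc ()) _        _
  step-out-difference (suc i) zero     zero     ()
  step-out-difference (suc i) zero     (suc j′) e rewrite suc-injective e =
    root , sym (∣1+n-n∣≡1 (2 ^ (3 + index i zero)))
  step-out-difference (suc i) (suc j)  zero     ()
  step-out-difference (suc i) (suc j)  (suc j′) e rewrite suc-injective e =
    node (suc i) (suc j) , sym (∣n-2n∣≡n (2 ^ (3 + index i j)))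

  LabelledDifference-sym : ∀ x y → LabelledDifference y x → LabelledDifference x y
  LabelledDifference-sym x y = map₂ (λ e → trans e (∣-∣-comm (value y) (value x)))

  adjacent-difference : ∀ {x y} → x ~ y → LabelledDifference x y
  adjacent-difference (root-first i)      = root-first-difference i
  adjacent-difference (step-out i j j′ e) = step-out-difference i j j′ e
  adjacent-difference (first-root i)      =
    LabelledDifference-sym (node i zero) root (root-first-difference i)
  adjacent-difference (step-in i j j′ e) =
    LabelledDifference-sym (node i j) (node i j′) (step-out-difference i j′ j e)

theorem3p10 : (k : ℕ) → 1 ≤ k → IsDifferenceGraph (OliveTree k)
theorem3p10 zero    ()
theorem3p10 (suc n) _ =
  value , value-injective , (λ x → ⟦⟧-positive (label x)) ,
  λ x y _ → mk⇔ adjacent-difference (λ (v , e) → difference-adjacent x y v e)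
  where open OliveLabelling n
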